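{- Let $G$ be a graph whose vertex set is the disjoint union of sets $K$ and $S$, where $K$ induces a clique, $S$ is an independent set, and $K$ and $S$ are complete to each other (every vertex of $K$ is adjacent to every vertex of $S$). (a) If $|S|<|K|$, then $G$ has a triangle packing of size $|S|\cdot\lfloor |K|/2\rfloor$. (b) If $|S|\ge |K|$, then $G$ has a triangle packing of size $\binom{|K|}{2}$.
   Context: A triangle packing of a graph is a family of pairwise edge-disjoint triangles of the graph. -}

module Defs where

open import Data.Nat using (ℕ; _<_; _≥_; _/_; _*_)
open import Data.Nat.Combinatorics using (_C_)
open import Data.Fin using (Fin) renaming (_<_ to _<ᶠ_)
open import Data.Bool using (Bool; true; false)
open import Data.List using (List; length; filter)
open import Data.List.Membership.Propositional using (_∈_)
open import Data.Product using (_×_; ∃-syntax; Σ)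
open import Data.Sum using (_⊎_)
open import Data.Vec.Functional using (Vector; toList)
open import Relation.Binary.PropositionalEquality using (_≡_)
open import Relation.Nullary using (¬_)

record Graph (n : ℕ) : Set₁ where
  field
    Adj     : Fin n → Fin n → Set
    sym     : ∀ {u v} → Adj u v → Adj v u
    irrefl  : ∀ {v} → ¬ Adj v v

open Graph public

record Triangle {n : ℕ} (G : Graph n) : Set where
  constructor triangle
  field
    a b c : Fin n
    a<b   : a <ᶠ b
    b<c   : b <ᶠ c
    ab    : Adj G a b
    bc    : Adj G b c
    ac    : Adj G a c

open Triangle public

_∈▵_ : ∀ {n} {G : Graph n} → Fin n → Triangle G → Set
v ∈▵ t = (v ≡ a t) ⊎ (v ≡ b t) ⊎ (v ≡ c t)

ShareEdge : ∀ {n} {G : Graph n} → Triangle G → Triangle G → Set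
ShareEdge t t' = ∃[ u ] ∃[ v ] (¬ u ≡ v × u ∈▵ t × v ∈▵ t × u ∈▵ t' × v ∈▵ t')

record TrianglePacking {n : ℕ} (G : Graph n) (m : ℕ) : Set where
  field
    tri      : Fin m → Triangle G
    disjoint : ∀ i j → ¬ i ≡ j → ¬ ShareEdge (tri i) (tri j)

count : ∀ {n} → (Fin n → Bool) → ℕ
count {n} P = length (filter (λ v → Data.Bool._≟_ (P v) true) (toList (λ v → v)))
  where import Data.Bool

-- The split structure: inK v = true means v ∈ K, otherwise v ∈ S.
-- K is a clique, S is independent, K complete to S.
record CliqueIndepSplit {n : ℕ} (G : Graph n) (inK : Fin n → Bool) : Set where
  field
    K-clique   : ∀ u v → inK u ≡ true → inK v ≡ true → ¬ u ≡ v → Adj G u v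
    S-indep    : ∀ u v → inK u ≡ false → inK v ≡ false → ¬ Adj G u v
    K-S-complete : ∀ u v → inK u ≡ true → inK v ≡ false → Adj G u v

module Submission where

-- Label K by ℤ_k.  If k ≤ s, join every pair {x, y} of K to the S-vertex x + y (mod k): two of
-- these triangles never share a K–S edge, because the colour x + y and one end x determine y.
-- If s < k, let D = 2g + 1 be the largest odd number ≤ k.  For a colour c < s the pairs
-- {c + u, c − u} (mod D), 1 ≤ u ≤ g, form a perfect matching of ℤ_D ∖ {c}; joined to the S-vertex c
-- they give g triangles.  Every such pair sums to 2c, and 2 is invertible modulo D, so a K–K edge
-- determines its colour; within one colour an end determines u.  When k is even, the last vertex ∞
-- of K is moreover joined with c, the vertex missed by the matching of colour c, to the S-vertex c.

open import Defs hiding (sym)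
open import Data.Bool using (Bool; true; false; not) renaming (_≟_ to _≟ᵇ_)
open import Data.Bool.Properties using (not-injective)
open import Data.Empty using (⊥-elim)
open import Data.Fin using (Fin; zero; suc; toℕ) renaming (_<_ to _<ᶠ_)
open import Data.Fin.Properties
  using (<-cmp; <⇒≢; <-asym; <-irrelevant; toℕ<n; toℕ-injective; toℕ-fromℕ<; inject≤-injective; +↔⊎; *↔×)
import Data.Fin.Properties as Fin
open import Data.List using (List; _∷_; lookup; allFin)
import Data.List.Relation.Unary.All as All
open import Data.List.Relation.Unary.Unique.Propositional using (Unique; _∷_)
open import Data.List.Relation.Unary.Unique.Propositional.Properties using (allFin⁺; filter⁺)
open import Data.List.Membership.Propositional.Properties using (∈-lookup; ∈-filter⁻)
open import Data.Nat using (ℕ; zero; suc; _+_; _*_; _∸_; _≤_; _<_; _≥_; s≤s; z≤n; NonZero)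
open import Data.Nat.Properties
  using (+-comm; +-suc; *-suc; ≤-pred; <⇒≤; ≤-trans; <-≤-trans; ≤-reflexive; <-irrefl; <⇒≱; n≮0;
         m≤m+n; +-mono-≤; m∸n≤m; m∸n+n≡m; m+[n∸m]≡n; ∸-cancelˡ-≡; m∸n≡0⇒m≤n)
import Data.Nat.Properties as ℕ
open import Data.Nat.DivMod
  using (_%_; _/_; _mod_; m%n<n; m<n⇒m%n≡m; m≡m%n+[m/n]*n; %-distribˡ-+; %-distribˡ-*; [m+n]%n≡m%n; [m+kn]%n≡m%n)
open import Data.Nat.Combinatorics using (_C_; nC1≡n; nCk+nC[k+1]≡[n+1]C[k+1])
open import Data.Nat.Tactic.RingSolver using (solve-∀)
open import Data.Product using (Σ-syntax; _×_; _,_; proj₁; proj₂)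
import Data.Product as Prod
open import Data.Sum using (_⊎_; inj₁; inj₂; [_,_])
import Data.Sum as Sum
open import Data.Sum.Properties using (inj₁-injective)
open import Data.Sum.Function.Propositional using (_⊎-↣_)
open import Data.Unit using (⊤; tt)
open import Function using (_∘_; id)
open import Function.Bundles using (_↣_; Injection; mk↣)
open import Function.Construct.Composition using (_↣-∘_)
open import Function.Properties.Injection using (↣-refl)
open import Function.Properties.Inverse using (↔⇒↣)
open import Relation.Binary.Definitions using (tri<; tri≈; tri>)
open import Relation.Binary.PropositionalEquality
  using (_≡_; _≢_; refl; sym; trans; cong; cong₂; subst; subst₂; module ≡-Reasoning)
open import Relation.Nullary using (¬_; Dec)

open Injection using (to; injective)

lookup-injective : ∀ {A : Set} {xs : List A} → Unique xs → ∀ {i j} → lookup xs i ≡ lookup xs j → i ≡ j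
lookup-injective (_ ∷ _) {zero} {zero} _ = refl
lookup-injective (x∉xs ∷ _) {zero} {suc j} x≡xsⱼ = ⊥-elim (All.lookup x∉xs (∈-lookup j) x≡xsⱼ)
lookup-injective (x∉xs ∷ _) {suc i} {zero} xsᵢ≡x = ⊥-elim (All.lookup x∉xs (∈-lookup i) (sym xsᵢ≡x))
lookup-injective (_ ∷ unique) {suc i} {suc j} eq = cong suc (lookup-injective unique eq)

enumerate : ∀ {n} (p : Fin n → Bool) → Σ[ e ∈ Fin (count p) ↣ Fin n ] (∀ i → p (to e i) ≡ true)
enumerate {n} p =
  mk↣ (lookup-injective (filter⁺ p? (allFin⁺ n))) , λ i → proj₂ (∈-filter⁻ p? {xs = allFin n} (∈-lookup i))
  where
  p? : ∀ v → Dec (p v ≡ true)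
  p? v = p v ≟ᵇ true

inject≤↣ : ∀ {m n} → m ≤ n → Fin m ↣ Fin n
inject≤↣ m≤n = mk↣ λ {i} {j} → inject≤-injective m≤n m≤n i j

⊎⊤↣suc : ∀ {n} → (Fin n ⊎ ⊤) ↣ Fin (suc n)
⊎⊤↣suc = mk↣ injective′
  where
  injective′ : ∀ {x y} → [ suc , (λ _ → zero) ] x ≡ [ suc , (λ _ → zero) ] y → x ≡ y
  injective′ {inj₁ _} {inj₁ _} e = cong inj₁ (Fin.suc-injective e)
  injective′ {inj₂ _} {inj₂ _} _ = refl
  injective′ {inj₁ _} {inj₂ _} ()
  injective′ {inj₂ _} {inj₁ _} ()

module _ {n} (P : Fin n → Set) where

  record IncreasingTriple : Set where
    constructor increasing
    field
      {a b c} : Fin n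
      a<b     : a <ᶠ b
      b<c     : b <ᶠ c
      Pa      : P a
      Pb      : P b
      Pc      : P c

  private
    insert : ∀ {a b z} → a <ᶠ b → P a → P b → P z → a ≢ z → b ≢ z → IncreasingTriple
    insert {a} {b} {z} a<b pa pb pz a≢z b≢z with <-cmp z a | <-cmp z b
    ... | tri< z<a _ _ | _            = increasing z<a a<b pz pa pb
    ... | tri≈ _ z≡a _ | _            = ⊥-elim (a≢z (sym z≡a))
    ... | tri> _ _ a<z | tri< z<b _ _ = increasing a<z z<b pa pz pb
    ... | tri> _ _ _   | tri≈ _ z≡b _ = ⊥-elim (b≢z (sym z≡b))
    ... | tri> _ _ _   | tri> _ _ b<z = increasing a<b b<z pa pb pz

  increasing-triple : ∀ {x y z} → P x → P y → P z → x ≢ y → x ≢ z → y ≢ z → IncreasingTriple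
  increasing-triple {x} {y} px py pz x≢y x≢z y≢z with <-cmp x y
  ... | tri< x<y _ _ = insert x<y px py pz x≢z y≢z
  ... | tri≈ _ x≡y _ = ⊥-elim (x≢y x≡y)
  ... | tri> _ _ y<x = insert y<x py px pz y≢z x≢z

module _ {n} (G : Graph n) (P : Fin n → Set) (clique : ∀ {u v} → P u → P v → u ≢ v → Adj G u v) where

  triangle-within : ∀ {x y z} → P x → P y → P z → x ≢ y → x ≢ z → y ≢ z →
                    Σ[ t ∈ Triangle G ] (∀ {v} → v ∈▵ t → P v)
  triangle-within px py pz x≢y x≢z y≢z with increasing-triple P px py pz x≢y x≢z y≢z
  ... | increasing a<b b<c pa pb pc =
    triangle _ _ _ a<b b<c (clique pa pb (<⇒≢ a<b)) (clique pb pc (<⇒≢ b<c))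
             (clique pa pc (<⇒≢ (Fin.<-trans a<b b<c)))
    , λ { (inj₁ refl) → pa ; (inj₂ (inj₁ refl)) → pb ; (inj₂ (inj₂ refl)) → pc }

record SplitTriangle (K S : Set) : Set where
  constructor splitTriangle
  field
    left right : K
    apex       : S
    left≢right : left ≢ right

open SplitTriangle

module _ {K S : Set} where

  _∈base_ : K → SplitTriangle K S → Set
  v ∈base t = v ≡ left t ⊎ v ≡ right t

  SameBase : SplitTriangle K S → SplitTriangle K S → Set
  SameBase t t′ = (left t ≡ left t′ × right t ≡ right t′) ⊎ (left t ≡ right t′ × right t ≡ left t′)

  _∈ᵛ_ : K ⊎ S → SplitTriangle K S → Set
  inj₁ v ∈ᵛ t = v ∈base t
  inj₂ c ∈ᵛ t = c ≡ apex t

  left∈base : ∀ {t t′} → SameBase t t′ → left t ∈base t′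
  left∈base = Sum.map proj₁ proj₁

  distinct∈base : ∀ {t u v} → u ≢ v → u ∈base t → v ∈base t →
                  (u ≡ left t × v ≡ right t) ⊎ (u ≡ right t × v ≡ left t)
  distinct∈base u≢v (inj₁ u≡l) (inj₁ v≡l) = ⊥-elim (u≢v (trans u≡l (sym v≡l)))
  distinct∈base u≢v (inj₁ u≡l) (inj₂ v≡r) = inj₁ (u≡l , v≡r)
  distinct∈base u≢v (inj₂ u≡r) (inj₁ v≡l) = inj₂ (u≡r , v≡l)
  distinct∈base u≢v (inj₂ u≡r) (inj₂ v≡r) = ⊥-elim (u≢v (trans u≡r (sym v≡r)))

  common-distinct⇒SameBase : ∀ {t t′ u v} → u ≢ v → u ∈base t → v ∈base t → u ∈base t′ → v ∈base t′ →
                             SameBase t t′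
  common-distinct⇒SameBase {t} {t′} u≢v ut vt ut′ vt′
    with distinct∈base {t} u≢v ut vt | distinct∈base {t′} u≢v ut′ vt′
  ... | inj₁ (u≡l , v≡r) | inj₁ (u≡l′ , v≡r′) = inj₁ (trans (sym u≡l) u≡l′ , trans (sym v≡r) v≡r′)
  ... | inj₁ (u≡l , v≡r) | inj₂ (u≡r′ , v≡l′) = inj₂ (trans (sym u≡l) u≡r′ , trans (sym v≡r) v≡l′)
  ... | inj₂ (u≡r , v≡l) | inj₁ (u≡l′ , v≡r′) = inj₂ (trans (sym v≡l) v≡r′ , trans (sym u≡r) u≡l′)
  ... | inj₂ (u≡r , v≡l) | inj₂ (u≡r′ , v≡l′) = inj₁ (trans (sym v≡l) v≡l′ , trans (sym u≡r) u≡r′)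

record IsSplitPacking {K S I : Set} (T : I → SplitTriangle K S) : Set where
  field
    base-injective : ∀ {i j} → SameBase (T i) (T j) → i ≡ j
    leg-injective  : ∀ {i j v} → apex (T i) ≡ apex (T j) → v ∈base T i → v ∈base T j → i ≡ j

  edge-injective : ∀ {i j w w′} → w ≢ w′ → w ∈ᵛ T i → w′ ∈ᵛ T i → w ∈ᵛ T j → w′ ∈ᵛ T j → i ≡ j
  edge-injective {i} {j} {inj₁ u} {inj₁ v} u≢v ui vi uj vj =
    base-injective (common-distinct⇒SameBase {t = T i} {t′ = T j} (u≢v ∘ cong inj₁) ui vi uj vj)
  edge-injective {w = inj₁ u} {inj₂ c} _ ui ci uj cj = leg-injective (trans (sym ci) cj) ui uj
  edge-injective {w = inj₂ c} {inj₁ u} _ ci ui cj uj = leg-injective (trans (sym ci) cj) ui uj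
  edge-injective {w = inj₂ c} {inj₂ c′} c≢c′ ci c′i _ _ = ⊥-elim (c≢c′ (cong inj₂ (trans ci (sym c′i))))

record SplitPacking (K S : Set) (m : ℕ) : Set₁ where
  field
    Index          : Set
    triangles      : Index → SplitTriangle K S
    isSplitPacking : IsSplitPacking triangles
    index          : Fin m ↣ Index

module _ {K K′ S S′ : Set} (κ : K ↣ K′) (σ : S ↣ S′) where

  mapSplitTriangle : SplitTriangle K S → SplitTriangle K′ S′
  mapSplitTriangle t =
    splitTriangle (to κ (left t)) (to κ (right t)) (to σ (apex t)) (left≢right t ∘ injective κ)

  ∈base-map⁻ : ∀ {x} t → to κ x ∈base mapSplitTriangle t → x ∈base t
  ∈base-map⁻ _ = Sum.map (injective κ) (injective κ)

  map-isSplitPacking : ∀ {I} {T : I → SplitTriangle K S} → IsSplitPacking T → IsSplitPacking (mapSplitTriangle ∘ T)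
  map-isSplitPacking {T = T} P = record
    { base-injective = base-injective ∘ Sum.map (Prod.map (injective κ) (injective κ))
                                                (Prod.map (injective κ) (injective κ))
    ; leg-injective  = leg
    }
    where
    open IsSplitPacking P
    leg : ∀ {i j v} → to σ (apex (T i)) ≡ to σ (apex (T j)) →
          v ∈base mapSplitTriangle (T i) → v ∈base mapSplitTriangle (T j) → i ≡ j
    leg {j = j} apex≡ (inj₁ refl) vj = leg-injective (injective σ apex≡) (inj₁ refl) (∈base-map⁻ (T j) vj)
    leg {j = j} apex≡ (inj₂ refl) vj = leg-injective (injective σ apex≡) (inj₂ refl) (∈base-map⁻ (T j) vj)

  relabel : ∀ {m} → SplitPacking K S m → SplitPacking K′ S′ m
  relabel P = record
    { Index = Index ; triangles = mapSplitTriangle ∘ triangles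
    ; isSplitPacking = map-isSplitPacking isSplitPacking ; index = index }
    where open SplitPacking P

module _ {K S I : Set} {T : I → SplitTriangle K S} (P : IsSplitPacking T)
         (free : S ↣ K) (free∉base : ∀ i → ¬ to free (apex (T i)) ∈base T i) where

  private
    inj₁↣ : K ↣ (K ⊎ ⊤)
    inj₁↣ = mk↣ inj₁-injective

  withInfinity : I ⊎ S → SplitTriangle (K ⊎ ⊤) S
  withInfinity (inj₁ i) = mapSplitTriangle inj₁↣ (mk↣ id) (T i)
  withInfinity (inj₂ c) = splitTriangle (inj₁ (to free c)) (inj₂ tt) c λ ()

  withInfinity-isSplitPacking : IsSplitPacking withInfinity
  withInfinity-isSplitPacking = record { base-injective = base ; leg-injective = leg }
    where
    open IsSplitPacking (map-isSplitPacking inj₁↣ (mk↣ id) P)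
    base : ∀ {i j} → SameBase (withInfinity i) (withInfinity j) → i ≡ j
    base {inj₁ _} {inj₁ _} same = cong inj₁ (base-injective same)
    base {inj₁ _} {inj₂ _} (inj₁ (_ , ()))
    base {inj₁ _} {inj₂ _} (inj₂ (() , _))
    base {inj₂ _} {inj₁ _} (inj₁ (_ , ()))
    base {inj₂ _} {inj₁ _} (inj₂ (_ , ()))
    base {inj₂ _} {inj₂ _} (inj₁ (free≡ , _)) = cong inj₂ (injective free (inj₁-injective free≡))
    base {inj₂ _} {inj₂ _} (inj₂ (() , _))
    leg : ∀ {i j v} → apex (withInfinity i) ≡ apex (withInfinity j) →
          v ∈base withInfinity i → v ∈base withInfinity j → i ≡ j
    leg {inj₁ _} {inj₁ _} apex≡ vi vj = cong inj₁ (leg-injective apex≡ vi vj)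
    leg {inj₁ i} {inj₂ _} refl vi (inj₁ refl) = ⊥-elim (free∉base i (∈base-map⁻ inj₁↣ (mk↣ id) (T i) vi))
    leg {inj₁ _} {inj₂ _} _ (inj₁ ()) (inj₂ refl)
    leg {inj₁ _} {inj₂ _} _ (inj₂ ()) (inj₂ refl)
    leg {inj₂ _} {inj₁ j} refl (inj₁ refl) vj = ⊥-elim (free∉base j (∈base-map⁻ inj₁↣ (mk↣ id) (T j) vj))
    leg {inj₂ _} {inj₁ _} _ (inj₂ refl) (inj₁ ())
    leg {inj₂ _} {inj₁ _} _ (inj₂ refl) (inj₂ ())
    leg {inj₂ _} {inj₂ _} refl _ _ = refl

module _ {n} {G : Graph n} {inK : Fin n → Bool} (split : CliqueIndepSplit G inK)
         {K S : Set} (κ : K ↣ Fin n) (κ-inK : ∀ x → inK (to κ x) ≡ true)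
         (σ : S ↣ Fin n) (σ-inK : ∀ c → inK (to σ c) ≡ false) where

  open CliqueIndepSplit split

  private
    embed : K ⊎ S → Fin n
    embed = [ to κ , to σ ]

    κ≢σ : ∀ {x c} → to κ x ≢ to σ c
    κ≢σ {x} {c} κx≡σc with trans (sym (κ-inK x)) (trans (cong inK κx≡σc) (σ-inK c))
    ... | ()

    embed-injective : ∀ {w w′} → embed w ≡ embed w′ → w ≡ w′
    embed-injective {inj₁ _} {inj₁ _} e = cong inj₁ (injective κ e)
    embed-injective {inj₁ _} {inj₂ _} e = ⊥-elim (κ≢σ e)
    embed-injective {inj₂ _} {inj₁ _} e = ⊥-elim (κ≢σ (sym e))
    embed-injective {inj₂ _} {inj₂ _} e = cong inj₂ (injective σ e)

    adjacent : ∀ {t w w′} → w ∈ᵛ t → w′ ∈ᵛ t → w ≢ w′ → Adj G (embed w) (embed w′)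
    adjacent {w = inj₁ x} {inj₁ y} _ _ x≢y = K-clique _ _ (κ-inK x) (κ-inK y) (x≢y ∘ cong inj₁ ∘ injective κ)
    adjacent {w = inj₁ x} {inj₂ c} _ _ _ = K-S-complete _ _ (κ-inK x) (σ-inK c)
    adjacent {w = inj₂ c} {inj₁ x} _ _ _ = Graph.sym G (K-S-complete _ _ (κ-inK x) (σ-inK c))
    adjacent {w = inj₂ c} {inj₂ c′} c∈t c′∈t c≢c′ = ⊥-elim (c≢c′ (cong inj₂ (trans c∈t (sym c′∈t))))

    Image : SplitTriangle K S → Fin n → Set
    Image t u = Σ[ w ∈ K ⊎ S ] w ∈ᵛ t × embed w ≡ u

    embedTriangle : (t : SplitTriangle K S) → Σ[ t′ ∈ Triangle G ] (∀ {u} → u ∈▵ t′ → Image t u)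
    embedTriangle t = triangle-within G (Image t) clique
      (inj₁ (left t) , inj₁ refl , refl) (inj₁ (right t) , inj₂ refl , refl) (inj₂ (apex t) , refl , refl)
      (left≢right t ∘ injective κ) κ≢σ κ≢σ
      where
      clique : ∀ {u v} → Image t u → Image t v → u ≢ v → Adj G u v
      clique (w , w∈t , refl) (w′ , w′∈t , refl) u≢v = adjacent w∈t w′∈t (u≢v ∘ cong embed)

    common : ∀ {t t′ u} → Image t u → Image t′ u → Σ[ w ∈ K ⊎ S ] w ∈ᵛ t × w ∈ᵛ t′ × embed w ≡ u
    common (w , w∈t , refl) (w′ , w′∈t′ , w′↦u) with embed-injective {w′} {w} w′↦u
    ... | refl = w , w∈t , w′∈t′ , refl

  trianglePacking : ∀ {m} → SplitPacking K S m → TrianglePacking G m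
  trianglePacking P = record { tri = proj₁ ∘ embedded ; disjoint = disjoint }
    where
    open SplitPacking P
    open IsSplitPacking isSplitPacking

    embedded : ∀ i → Σ[ t′ ∈ Triangle G ] (∀ {u} → u ∈▵ t′ → Image (triangles (to index i)) u)
    embedded i = embedTriangle (triangles (to index i))

    disjoint : ∀ i j → i ≢ j → ¬ ShareEdge (proj₁ (embedded i)) (proj₁ (embedded j))
    disjoint i j i≢j (u , v , u≢v , ui , vi , uj , vj)
      with common (proj₂ (embedded i) ui) (proj₂ (embedded j) uj)
         | common (proj₂ (embedded i) vi) (proj₂ (embedded j) vj)
    ... | w , wi , wj , refl | w′ , w′i , w′j , refl =
      i≢j (injective index (edge-injective (u≢v ∘ cong embed) wi w′i wj w′j))

private
  -- a + d * a is a multiple of suc d, so adding d * a undoes adding a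
  undo-+ : ∀ a d z → z + a * suc d ≡ (a + z) + d * a
  undo-+ = solve-∀

  -- suc g is the inverse of 2 modulo 2g + 1
  halve : ∀ g x → x + x * suc (g + g) ≡ suc g * (x + x)
  halve = solve-∀

  +-exchange : ∀ x l r → (x + l) + (x + r) ≡ (x + x) + (l + r)
  +-exchange = solve-∀

  *2≡+ : ∀ h → h * 2 ≡ h + h
  *2≡+ = solve-∀

module _ {n} .{{_ : NonZero n}} where
  open ≡-Reasoning

  %-cong-+ʳ : ∀ {x y} z → x % n ≡ y % n → (x + z) % n ≡ (y + z) % n
  %-cong-+ʳ {x} {y} z x≡y = begin
    (x + z) % n          ≡⟨ %-distribˡ-+ x z n ⟩
    (x % n + z % n) % n  ≡⟨ cong (λ a → (a + z % n) % n) x≡y ⟩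
    (y % n + z % n) % n  ≡⟨ %-distribˡ-+ y z n ⟨
    (y + z) % n          ∎

  %-cong-*ˡ : ∀ z {x y} → x % n ≡ y % n → (z * x) % n ≡ (z * y) % n
  %-cong-*ˡ z {x} {y} x≡y = begin
    (z * x) % n              ≡⟨ %-distribˡ-* z x n ⟩
    (z % n * (x % n)) % n    ≡⟨ cong (λ a → (z % n * a) % n) x≡y ⟩
    (z % n * (y % n)) % n    ≡⟨ %-distribˡ-* z y n ⟨
    (z * y) % n              ∎

  <⇒%-injective : ∀ {x y} → x < n → y < n → x % n ≡ y % n → x ≡ y
  <⇒%-injective x<n y<n x≡y = trans (sym (m<n⇒m%n≡m x<n)) (trans x≡y (m<n⇒m%n≡m y<n))

  mod≡⇒%≡ : ∀ {x y} → x mod n ≡ y mod n → x % n ≡ y % n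
  mod≡⇒%≡ {x} {y} x≡y =
    trans (sym (toℕ-fromℕ< (m%n<n x n))) (trans (cong toℕ x≡y) (toℕ-fromℕ< (m%n<n y n)))

+-cancelˡ-% : ∀ {d} a {x y} → (a + x) % suc d ≡ (a + y) % suc d → x % suc d ≡ y % suc d
+-cancelˡ-% {d} a {x} {y} eq = begin
  x % suc d                  ≡⟨ [m+kn]%n≡m%n x a (suc d) ⟨
  (x + a * suc d) % suc d    ≡⟨ cong (_% suc d) (undo-+ a d x) ⟩
  ((a + x) + d * a) % suc d  ≡⟨ %-cong-+ʳ {x = a + x} {a + y} (d * a) eq ⟩
  ((a + y) + d * a) % suc d  ≡⟨ cong (_% suc d) (undo-+ a d y) ⟨
  (y + a * suc d) % suc d    ≡⟨ [m+kn]%n≡m%n y a (suc d) ⟩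
  y % suc d                  ∎
  where open ≡-Reasoning

mod-cancelˡ : ∀ {d} a {x y} → x < suc d → y < suc d → (a + x) mod suc d ≡ (a + y) mod suc d → x ≡ y
mod-cancelˡ {d} a {x} {y} x<n y<n eq =
  <⇒%-injective {x = x} {y} x<n y<n (+-cancelˡ-% {d} a {x} {y} (mod≡⇒%≡ {x = a + x} {a + y} eq))

double-cancel-% : ∀ g {x y} → (x + x) % suc (g + g) ≡ (y + y) % suc (g + g) → x % suc (g + g) ≡ y % suc (g + g)
double-cancel-% g {x} {y} eq = begin
  x % D                  ≡⟨ [m+kn]%n≡m%n x x D ⟨
  (x + x * D) % D        ≡⟨ cong (_% D) (halve g x) ⟩
  (suc g * (x + x)) % D  ≡⟨ %-cong-*ˡ (suc g) {x + x} {y + y} eq ⟩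
  (suc g * (y + y)) % D  ≡⟨ cong (_% D) (halve g y) ⟨
  (y + y * D) % D        ≡⟨ [m+kn]%n≡m%n y y D ⟩
  y % D                  ∎
  where
  open ≡-Reasoning
  D : ℕ
  D = suc (g + g)

parity : ∀ k → k ≡ suc (k / 2 + k / 2) ⊎ k ≡ k / 2 + k / 2
parity k with k % 2 | m%n<n k 2 | m≡m%n+[m/n]*n k 2
... | 0           | _            | k≡ = inj₂ (trans k≡ (*2≡+ (k / 2)))
... | 1           | _            | k≡ = inj₁ (trans k≡ (cong suc (*2≡+ (k / 2))))
... | suc (suc _) | s≤s (s≤s ()) | _

record OrderedPair (D : ℕ) : Set where
  constructor orderedPair
  field
    {lo hi} : Fin D
    lo<hi   : lo <ᶠ hi

open OrderedPair

orderedPair-≡ : ∀ {D} {p q : OrderedPair D} → lo p ≡ lo q → hi p ≡ hi q → p ≡ q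
orderedPair-≡ {p = orderedPair x} {orderedPair y} refl refl = cong orderedPair (<-irrelevant x y)

orderedPairs : ∀ D → Fin (D C 2) ↣ OrderedPair D
orderedPairs zero    = mk↣ {to = λ ()} λ { {()} }
orderedPairs (suc D) = subst (λ m → Fin m ↣ OrderedPair (suc D)) C2-suc
  (mk↣ extend-injective ↣-∘ ((orderedPairs D ⊎-↣ ↣-refl) ↣-∘ ↔⇒↣ +↔⊎))
  where
  extend : OrderedPair D ⊎ Fin D → OrderedPair (suc D)
  extend (inj₁ (orderedPair lo<hi)) = orderedPair (s≤s lo<hi)
  extend (inj₂ i)                   = orderedPair {lo = zero} {hi = suc i} (s≤s z≤n)

  extend-injective : ∀ {x y} → extend x ≡ extend y → x ≡ y
  extend-injective {inj₁ (orderedPair _)} {inj₁ (orderedPair _)} refl = refl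
  extend-injective {inj₂ _} {inj₂ _} refl = refl

  C2-suc : D C 2 + D ≡ suc D C 2
  C2-suc = trans (cong (D C 2 +_) (sym (nC1≡n D)))
                 (trans (+-comm (D C 2) (D C 1)) (nCk+nC[k+1]≡[n+1]C[k+1] D 1))

module _ {d : ℕ} where

  infixl 6 _⊕_
  opaque
    _⊕_ : Fin (suc d) → Fin (suc d) → Fin (suc d)
    x ⊕ y = (toℕ x + toℕ y) mod suc d

    ⊕-comm : ∀ x y → x ⊕ y ≡ y ⊕ x
    ⊕-comm x y = cong (_mod suc d) (+-comm (toℕ x) (toℕ y))

    ⊕-cancelˡ : ∀ {x y y′} → x ⊕ y ≡ x ⊕ y′ → y ≡ y′
    ⊕-cancelˡ {x} {y} {y′} eq = toℕ-injective (mod-cancelˡ (toℕ x) (toℕ<n y) (toℕ<n y′) eq)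

  sumTriangle : OrderedPair (suc d) → SplitTriangle (Fin (suc d)) (Fin (suc d))
  sumTriangle p = splitTriangle (lo p) (hi p) (lo p ⊕ hi p) (<⇒≢ (lo<hi p))

  ⊕-sameBase : ∀ {p q v} → lo p ⊕ hi p ≡ lo q ⊕ hi q → v ∈base sumTriangle p → v ∈base sumTriangle q →
               SameBase (sumTriangle p) (sumTriangle q)
  ⊕-sameBase {p} {q} eq (inj₁ refl) (inj₁ refl) = inj₁ (refl , ⊕-cancelˡ eq)
  ⊕-sameBase {p} {q} eq (inj₁ refl) (inj₂ refl) = inj₂ (refl , ⊕-cancelˡ (trans eq (⊕-comm (lo q) (hi q))))
  ⊕-sameBase {p} {q} eq (inj₂ refl) (inj₁ refl) = inj₂ (⊕-cancelˡ (trans (⊕-comm (hi p) (lo p)) eq) , refl)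
  ⊕-sameBase {p} {q} eq (inj₂ refl) (inj₂ refl) =
    inj₁ (⊕-cancelˡ (trans (⊕-comm (hi p) (lo p)) (trans eq (⊕-comm (lo q) (hi q)))) , refl)

  sum-isSplitPacking : IsSplitPacking sumTriangle
  sum-isSplitPacking = record
    { base-injective = base ; leg-injective = λ {p} {q} eq vp vq → base (⊕-sameBase {p} {q} eq vp vq) }
    where
    base : ∀ {p q} → SameBase (sumTriangle p) (sumTriangle q) → p ≡ q
    base (inj₁ (lo≡ , hi≡)) = orderedPair-≡ lo≡ hi≡
    base {p} {q} (inj₂ (lo≡hi′ , hi≡lo′)) =
      ⊥-elim (<-asym (lo<hi p) (subst₂ _<ᶠ_ (sym hi≡lo′) (sym lo≡hi′) (lo<hi q)))

sumPacking : ∀ D → SplitPacking (Fin D) (Fin D) (D C 2)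
sumPacking zero = record
  { Index = Fin 0 ; triangles = λ () ; index = ↣-refl
  ; isSplitPacking = record { base-injective = λ { {()} } ; leg-injective = λ { {()} } } }
sumPacking (suc d) = record
  { Index = OrderedPair (suc d) ; triangles = sumTriangle ; isSplitPacking = sum-isSplitPacking
  ; index = orderedPairs (suc d) }

module _ (g : ℕ) {s : ℕ} (s≤D : s ≤ suc (g + g)) where

  private
    D : ℕ
    D = suc (g + g)

  offset⁺ offset⁻ : Fin g → ℕ
  offset⁺ t = suc (toℕ t)
  offset⁻ t = D ∸ offset⁺ t

  IsOffset : Fin g → ℕ → Set
  IsOffset t o = o ≡ offset⁺ t ⊎ o ≡ offset⁻ t

  offset⁺<D : ∀ t → offset⁺ t < D
  offset⁺<D t = s≤s (≤-trans (toℕ<n t) (m≤m+n g g))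

  offset⁻<D : ∀ t → offset⁻ t < D
  offset⁻<D t = s≤s (m∸n≤m (g + g) (toℕ t))

  offset<D : ∀ {t o} → IsOffset t o → o < D
  offset<D {t} (inj₁ refl) = offset⁺<D t
  offset<D {t} (inj₂ refl) = offset⁻<D t

  offset⁺≢offset⁻ : ∀ {t t′} → offset⁺ t ≢ offset⁻ t′
  offset⁺≢offset⁻ {t} {t′} eq = <-irrefl sum≡D (s≤s (+-mono-≤ (toℕ<n t) (toℕ<n t′)))
    where
    sum≡D : offset⁺ t + offset⁺ t′ ≡ D
    sum≡D = trans (cong (_+ offset⁺ t′) eq) (m∸n+n≡m (<⇒≤ (offset⁺<D t′)))

  offset-injective : ∀ {t t′ o} → IsOffset t o → IsOffset t′ o → t ≡ t′
  offset-injective (inj₁ refl) (inj₁ e) = toℕ-injective (ℕ.suc-injective e)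
  offset-injective {t} {t′} (inj₁ refl) (inj₂ e) = ⊥-elim (offset⁺≢offset⁻ {t} {t′} e)
  offset-injective {t} {t′} (inj₂ refl) (inj₁ e) = ⊥-elim (offset⁺≢offset⁻ {t′} {t} (sym e))
  offset-injective {t} {t′} (inj₂ refl) (inj₂ e) =
    toℕ-injective (ℕ.suc-injective (∸-cancelˡ-≡ (<⇒≤ (offset⁺<D t)) (<⇒≤ (offset⁺<D t′)) e))

  0∉offsets : ∀ {t} → ¬ IsOffset t 0
  0∉offsets {t} (inj₂ 0≡offset⁻) = <⇒≱ (offset⁺<D t) (m∸n≡0⇒m≤n (sym 0≡offset⁻))

  toℕ<D : ∀ (c : Fin s) → toℕ c < D
  toℕ<D c = <-≤-trans (toℕ<n c) s≤D

  opaque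
    end : Fin s → ℕ → Fin D
    end c o = (toℕ c + o) mod D

    toℕ-end : ∀ c o → toℕ (end c o) ≡ (toℕ c + o) % D
    toℕ-end c o = toℕ-fromℕ< (m%n<n (toℕ c + o) D)

    end-cancelˡ : ∀ {c o o′} → o < D → o′ < D → end c o ≡ end c o′ → o ≡ o′
    end-cancelˡ {c} = mod-cancelˡ (toℕ c)

    end-cancelʳ : ∀ {c c′ o} → end c o ≡ end c′ o → c ≡ c′
    end-cancelʳ {c} {c′} {o} eq = toℕ-injective (mod-cancelˡ o (toℕ<D c) (toℕ<D c′)
      (subst₂ (λ a b → a mod D ≡ b mod D) (+-comm (toℕ c) o) (+-comm (toℕ c′) o) eq))

  end-sum : ∀ c t → (toℕ (end c (offset⁺ t)) + toℕ (end c (offset⁻ t))) % D ≡ (toℕ c + toℕ c) % D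
  end-sum c t = begin
    (toℕ (end c l) + toℕ (end c r)) % D  ≡⟨ cong₂ (λ a b → (a + b) % D) (toℕ-end c l) (toℕ-end c r) ⟩
    ((x + l) % D + (x + r) % D) % D      ≡⟨ %-distribˡ-+ (x + l) (x + r) D ⟨
    ((x + l) + (x + r)) % D              ≡⟨ cong (_% D) (+-exchange x l r) ⟩
    ((x + x) + (l + r)) % D              ≡⟨ cong (λ a → ((x + x) + a) % D) (m+[n∸m]≡n (<⇒≤ (offset⁺<D t))) ⟩
    ((x + x) + D) % D                    ≡⟨ [m+n]%n≡m%n (x + x) D ⟩
    (x + x) % D                          ∎
    where
    open ≡-Reasoning
    x l r : ℕ
    x = toℕ c
    l = offset⁺ t
    r = offset⁻ t

  matchingTriangle : Fin s × Fin g → SplitTriangle (Fin D) (Fin s)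
  matchingTriangle (c , t) = splitTriangle (end c (offset⁺ t)) (end c (offset⁻ t)) c
    (offset⁺≢offset⁻ {t} {t} ∘ end-cancelˡ (offset⁺<D t) (offset⁻<D t))

  ∈base⇒offset : ∀ {c t v} → v ∈base matchingTriangle (c , t) → Σ[ o ∈ ℕ ] IsOffset t o × v ≡ end c o
  ∈base⇒offset {t = t} (inj₁ v≡) = offset⁺ t , inj₁ refl , v≡
  ∈base⇒offset {t = t} (inj₂ v≡) = offset⁻ t , inj₂ refl , v≡

  sameBase⇒sum : ∀ (t t′ : SplitTriangle (Fin D) (Fin s)) → SameBase t t′ →
                 toℕ (left t) + toℕ (right t) ≡ toℕ (left t′) + toℕ (right t′)
  sameBase⇒sum _ _  (inj₁ (l≡ , r≡)) = cong₂ _+_ (cong toℕ l≡) (cong toℕ r≡)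
  sameBase⇒sum _ t′ (inj₂ (l≡ , r≡)) =
    trans (cong₂ _+_ (cong toℕ l≡) (cong toℕ r≡)) (+-comm (toℕ (right t′)) (toℕ (left t′)))

  sameBase⇒sameApex : ∀ {c c′ t t′} →
                      SameBase (matchingTriangle (c , t)) (matchingTriangle (c′ , t′)) → c ≡ c′
  sameBase⇒sameApex {c} {c′} {t} {t′} same =
    toℕ-injective (<⇒%-injective {x = toℕ c} {toℕ c′} (toℕ<D c) (toℕ<D c′)
                                 (double-cancel-% g {toℕ c} {toℕ c′} (begin
      (toℕ c + toℕ c) % D
        ≡⟨ end-sum c t ⟨
      (toℕ (end c (offset⁺ t)) + toℕ (end c (offset⁻ t))) % D
        ≡⟨ cong (_% D) (sameBase⇒sum (matchingTriangle (c , t)) (matchingTriangle (c′ , t′)) same) ⟩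
      (toℕ (end c′ (offset⁺ t′)) + toℕ (end c′ (offset⁻ t′))) % D
        ≡⟨ end-sum c′ t′ ⟩
      (toℕ c′ + toℕ c′) % D
        ∎)))
    where open ≡-Reasoning

  matching-isSplitPacking : IsSplitPacking matchingTriangle
  matching-isSplitPacking = record { base-injective = base ; leg-injective = leg }
    where
    leg : ∀ {i j v} → apex (matchingTriangle i) ≡ apex (matchingTriangle j) →
          v ∈base matchingTriangle i → v ∈base matchingTriangle j → i ≡ j
    leg {c , t} {_ , t′} refl vi vj with ∈base⇒offset {c} {t} vi | ∈base⇒offset {c} {t′} vj
    ... | o , o∈t , refl | o′ , o′∈t′ , v≡ with end-cancelˡ (offset<D o∈t) (offset<D o′∈t′) v≡
    ... | refl = cong (c ,_) (offset-injective o∈t o′∈t′)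

    base : ∀ {i j} → SameBase (matchingTriangle i) (matchingTriangle j) → i ≡ j
    base {c , t} {c′ , t′} same with sameBase⇒sameApex {c} {c′} {t} {t′} same
    ... | refl = leg refl (inj₁ refl) (left∈base {t = matchingTriangle (c , t)} {matchingTriangle (c , t′)} same)

  free : Fin s ↣ Fin D
  free = mk↣ λ {c} {c′} → end-cancelʳ {c} {c′} {0}

  free∉base : ∀ i → ¬ to free (apex (matchingTriangle i)) ∈base matchingTriangle i
  free∉base (c , t) v∈base with ∈base⇒offset {c} {t} v∈base
  ... | o , o∈t , free≡end =
    0∉offsets (subst (IsOffset t) (sym (end-cancelˡ (s≤s z≤n) (offset<D o∈t) free≡end)) o∈t)

  matchingPacking : SplitPacking (Fin D) (Fin s) (s * g)
  matchingPacking = record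
    { Index = Fin s × Fin g ; triangles = matchingTriangle
    ; isSplitPacking = matching-isSplitPacking ; index = ↔⇒↣ *↔× }

  matchingPacking∞ : SplitPacking (Fin D ⊎ ⊤) (Fin s) (s * suc g)
  matchingPacking∞ = record
    { Index = (Fin s × Fin g) ⊎ Fin s
    ; triangles = withInfinity matching-isSplitPacking free free∉base
    ; isSplitPacking = withInfinity-isSplitPacking matching-isSplitPacking free free∉base
    ; index = subst (λ m → Fin m ↣ ((Fin s × Fin g) ⊎ Fin s)) size
                    ((↔⇒↣ *↔× ⊎-↣ ↣-refl) ↣-∘ ↔⇒↣ +↔⊎) }
    where
    size : s * g + s ≡ s * suc g
    size = trans (+-comm (s * g) s) (sym (*-suc s g))

halfPacking : ∀ {k s} → s < k → SplitPacking (Fin k) (Fin s) (s * (k / 2))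
halfPacking {k} {s} s<k with k / 2 | parity k
... | g     | inj₁ refl = matchingPacking g (<⇒≤ s<k)
... | zero  | inj₂ refl = ⊥-elim (n≮0 s<k)
... | suc g | inj₂ refl = relabel (inject≤↣ (≤-reflexive (sym 2g+2≡)) ↣-∘ ⊎⊤↣suc) ↣-refl
                                  (matchingPacking∞ g (≤-pred (subst (s <_) 2g+2≡ s<k)))
  where
  2g+2≡ : suc g + suc g ≡ suc (suc (g + g))
  2g+2≡ = cong suc (+-suc g g)

corollary6 : (n : ℕ) (G : Graph n) (inK : Fin n → Bool) → CliqueIndepSplit G inK →
    ((count (λ v → not (inK v)) < count inK → TrianglePacking G (count (λ v → not (inK v)) * (count inK / 2)))
    × (count (λ v → not (inK v)) ≥ count inK → TrianglePacking G (count inK C 2)))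
corollary6 n G inK split =
    (λ s<k → realise (halfPacking s<k))
  , (λ k≤s → realise (relabel ↣-refl (inject≤↣ k≤s) (sumPacking (count inK))))
  where
  κ : Σ[ e ∈ Fin (count inK) ↣ Fin n ] (∀ i → inK (to e i) ≡ true)
  κ = enumerate inK
  σ : Σ[ e ∈ Fin (count (λ v → not (inK v))) ↣ Fin n ] (∀ i → not (inK (to e i)) ≡ true)
  σ = enumerate (λ v → not (inK v))
  realise : ∀ {m} → SplitPacking (Fin (count inK)) (Fin (count (λ v → not (inK v)))) m → TrianglePacking G m
  realise = trianglePacking split (proj₁ κ) (proj₂ κ) (proj₁ σ) (not-injective ∘ proj₂ σ)
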